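{- Let $G$ be a group and let $\pi=\{C_1,\dots,C_\ell\}$ be a collection of $\ell$ distinct subsets of $G$, each of size $k$ and containing the identity $e$, such that any two distinct cells intersect exactly in $\{e\}$ and $\pi$ satisfies the $T$-axiom. Then the Cayley incidence graph $\mathrm{BCay}(G,\pi)$ has girth at least six, i.e. it contains no cycle of length less than six.
   Context: For $C\subseteq G$ and $g\in G$, $gC=\{gs:s\in C\}$. A collection $\pi$ of subsets of $G$, each containing $e$, satisfies the $T$-axiom if for every $C\in\pi$ and every $s\in C$ we have $s^{ -1}C\in\pi$. The Cayley incidence graph $\mathrm{BCay}(G,\pi)$ is the bipartite graph with parts $\gamma=G$ and $\beta=\{gC:g\in G,C\in\pi\}$ (a set of subsets of $G$, so equal translates give one vertex), with an edge between $g$ and $gC$ for every $g\in G$, $C\in\pi$; equivalently $g\in\gamma$ is adjacent to $D\in\beta$ iff $g\in D$. -}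

module Defs where

open import Level using (Level; _⊔_)
open import Algebra.Bundles using (Group)
open import Data.Nat using (ℕ; zero; suc; _≤_)
open import Data.Fin using (Fin; zero; suc)
open import Data.Maybe using (Maybe; just; nothing; maybe)
import Data.Maybe as Maybe
open import Data.Product using (Σ; ∃; _×_; _,_)
open import Relation.Binary.PropositionalEquality using (_≡_)
open import Relation.Nullary using (¬_)
open import Function using (id)

next : ∀ {m} → Fin m → Maybe (Fin m)
next {suc zero} zero = nothing
next {suc (suc m)} zero = just (suc zero)
next {suc (suc m)} (suc i) = Maybe.map suc (next i)

csuc : ∀ {m} → Fin m → Fin m
csuc {suc m} i = maybe id zero (next i)

module _ {c ℓ : Level} (G : Group c ℓ) where
  open Group G

  -- A finite subset of G of size k, given by an enumeration Fin k → G
  -- (injectivity up to ≈ is imposed separately, making the size exactly k).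
  Cell : ℕ → Set c
  Cell k = Fin k → Carrier

  _∈C_ : ∀ {k} → Carrier → Cell k → Set ℓ
  x ∈C C = ∃ λ j → x ≈ C j

  _∈T_ : ∀ {k} → Carrier → (Carrier × Cell k) → Set ℓ
  x ∈T (g , C) = ∃ λ j → x ≈ g ∙ C j

  _≐_ : (A B : Carrier → Set ℓ) → Set (c ⊔ ℓ)
  A ≐ B = ∀ x → (A x → B x) × (B x → A x)

  module _ {n k : ℕ} (π : Fin n → Cell k) where

    cellSet : Fin n → Carrier → Set ℓ
    cellSet i x = x ∈C π i

    CellsDistinct : Set (c ⊔ ℓ)
    CellsDistinct = ∀ i j → ¬ (i ≡ j) → ¬ (cellSet i ≐ cellSet j)

    CellsOfSizeK : Set ℓ
    CellsOfSizeK = ∀ i (a b : Fin k) → π i a ≈ π i b → a ≡ b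

    CellsContainIdentity : Set ℓ
    CellsContainIdentity = ∀ i → ε ∈C π i

    TrivialIntersections : Set (c ⊔ ℓ)
    TrivialIntersections = ∀ i j → ¬ (i ≡ j) → ∀ x → x ∈C π i → x ∈C π j → x ≈ ε

    TAxiom : Set (c ⊔ ℓ)
    TAxiom = ∀ i s → s ∈C π i →
      ∃ λ j → (λ x → x ∈T (s ⁻¹ , π i)) ≐ cellSet j

    -- Cayley incidence graph BCay(G, π):
    --   γ-vertices: elements of G
    --   β-vertices: translates gC (g ∈ G, C ∈ π), presented by pairs (g , i),
    --     two pairs denoting the same vertex iff the translates are equal sets
    --   g adjacent to D iff g ∈ D.
    BVert : Set c
    BVert = Carrier × Fin n

    _∈β_ : Carrier → BVert → Set ℓ
    x ∈β (g , i) = x ∈T (g , π i)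

    SameβVertex : BVert → BVert → Set (c ⊔ ℓ)
    SameβVertex D D′ = (λ x → x ∈β D) ≐ (λ x → x ∈β D′)

    -- A cycle of length 2m in the bipartite graph BCay(G,π) (m ≥ 2):
    --   g₀ D₀ g₁ D₁ … g_{m-1} D_{m-1} g₀ with all vertices distinct,
    --   gᵢ ∈ Dᵢ and g_{i+1 mod m} ∈ Dᵢ.
    record Cycle (m : ℕ) : Set (c ⊔ ℓ) where
      field
        atLeastTwo : 2 ≤ m
        gs : Fin m → Carrier
        Ds : Fin m → BVert
        gs-distinct : ∀ i j → gs i ≈ gs j → i ≡ j
        Ds-distinct : ∀ i j → SameβVertex (Ds i) (Ds j) → i ≡ j
        adj-here : ∀ i → gs i ∈β Ds i
        adj-next : ∀ i → gs (csuc i) ∈β Ds i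

-- If a point x lies on the translate D = aC with x = a s (s ∈ C), then x⁻¹D = s⁻¹C, which is a
-- cell by the T-axiom. So if two distinct points x, y both lie on translates D and D′, then x⁻¹D
-- and x⁻¹D′ are cells that both contain x⁻¹y ≠ e; as distinct cells meet only in e, they are the
-- same cell, and hence D = D′. This rules out 4-cycles, and BCay(G, π) is bipartite, so it has no
-- cycles of length below six.
module Submission where

open import Defs hiding (_∈T_; _∈β_; _≐_)
open import Level using (Level; _⊔_)
open import Algebra.Bundles using (Group)
open import Data.Nat using (ℕ; _≤_; _*_; zero; suc; s≤s; z≤n)
open import Data.Nat.Properties using (*-monoʳ-≤)
open import Data.Fin using (Fin; zero; suc; _≟_)
open import Data.Product using (∃; _×_; _,_; proj₁; proj₂)
open import Relation.Binary.PropositionalEquality as ≡ using (_≡_)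
open import Relation.Nullary using (¬_; yes; no)
open import Data.Empty using (⊥-elim)
import Algebra.Properties.Group as GroupProperties
import Relation.Binary.Reasoning.Setoid as SetoidReasoning

module _ {c ℓ : Level} (G : Group c ℓ) where
  open Group G
  open GroupProperties G
  open SetoidReasoning setoid

  infix 4 _∈T_ _≐_
  _≐_ : (A B : Carrier → Set ℓ) → Set (c ⊔ ℓ)
  _≐_ = Defs._≐_ G

  _∈T_ : ∀ {k} → Carrier → Carrier × Cell G k → Set ℓ
  _∈T_ = Defs._∈T_ G

  ≐-sym : ∀ {A B} → A ≐ B → B ≐ A
  ≐-sym A≐B x = proj₂ (A≐B x) , proj₁ (A≐B x)

  ≐-trans : ∀ {A B C} → A ≐ B → B ≐ C → A ≐ C
  ≐-trans A≐B B≐C x = (λ a → proj₁ (B≐C x) (proj₁ (A≐B x) a))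
                    , (λ c → proj₂ (A≐B x) (proj₂ (B≐C x) c))

  ⁻¹∙factor : ∀ {x a s} → x ≈ a ∙ s → x ⁻¹ ∙ a ≈ s ⁻¹
  ⁻¹∙factor {x} {a} {s} x≈as = begin
    x ⁻¹ ∙ a             ≈⟨ ∙-congʳ (⁻¹-cong x≈as) ⟩
    (a ∙ s) ⁻¹ ∙ a       ≈⟨ ∙-congʳ (⁻¹-anti-homo-∙ a s) ⟩
    (s ⁻¹ ∙ a ⁻¹) ∙ a    ≈⟨ assoc (s ⁻¹) (a ⁻¹) a ⟩
    s ⁻¹ ∙ (a ⁻¹ ∙ a)    ≈⟨ ∙-congˡ (inverseˡ a) ⟩
    s ⁻¹ ∙ ε             ≈⟨ identityʳ (s ⁻¹) ⟩
    s ⁻¹                 ∎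

  ⁻¹∙translate : ∀ {x a s} → x ≈ a ∙ s → ∀ u → x ⁻¹ ∙ (a ∙ u) ≈ s ⁻¹ ∙ u
  ⁻¹∙translate {x} {a} {s} x≈as u = begin
    x ⁻¹ ∙ (a ∙ u)   ≈⟨ assoc (x ⁻¹) a u ⟨
    (x ⁻¹ ∙ a) ∙ u   ≈⟨ ∙-congʳ (⁻¹∙factor x≈as) ⟩
    s ⁻¹ ∙ u         ∎

  ∈T-retranslate : ∀ {k x a s} (C : Cell G k) → x ≈ a ∙ s →
    (λ z → z ∈T (a , C)) ≐ (λ z → x ⁻¹ ∙ z ∈T (s ⁻¹ , C))
  ∈T-retranslate {x = x} {a} C x≈as z =
      (λ (j , z≈aCj) → j , trans (∙-congˡ z≈aCj) (⁻¹∙translate x≈as (C j)))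
    , (λ (j , x⁻¹z≈s⁻¹Cj) → j , ∙-cancelˡ (x ⁻¹) z (a ∙ C j)
                                  (trans x⁻¹z≈s⁻¹Cj (sym (⁻¹∙translate x≈as (C j)))))

  ⁻¹∙≈ε⇒≈ : ∀ {x y} → x ⁻¹ ∙ y ≈ ε → x ≈ y
  ⁻¹∙≈ε⇒≈ {x} {y} x⁻¹y≈ε = ⁻¹-injective (inverseˡ-unique (x ⁻¹) y x⁻¹y≈ε)

  module _ {n k : ℕ} (π : Fin n → Cell G k) where

    infix 4 _∈β_
    _∈β_ : Carrier → BVert G π → Set ℓ
    _∈β_ = Defs._∈β_ G π

    module _ (tAxiom : TAxiom G π) where

      ⁻¹∙translate-is-cell : ∀ {x} (D : BVert G π) → x ∈β D →
        ∃ λ i → (λ z → z ∈β D) ≐ (λ z → cellSet G π i (x ⁻¹ ∙ z))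
      ⁻¹∙translate-is-cell {x} (a , i) (j , x≈aCj) with tAxiom i (π i j) (j , refl)
      ... | i′ , s⁻¹C≐Ci′ = i′ , ≐-trans (∈T-retranslate (π i) x≈aCj) (λ z → s⁻¹C≐Ci′ (x ⁻¹ ∙ z))

      module _ (trivialIntersections : TrivialIntersections G π) where

        translates-sharing-two-points-coincide : ∀ {x y} (D D′ : BVert G π) →
          x ∈β D → y ∈β D → x ∈β D′ → y ∈β D′ → ¬ x ≈ y → SameβVertex G π D D′
        translates-sharing-two-points-coincide {x} {y} D D′ x∈D y∈D x∈D′ y∈D′ x≉y
          with ⁻¹∙translate-is-cell D x∈D | ⁻¹∙translate-is-cell D′ x∈D′
        ... | i , D≐xCi | i′ , D′≐xCi′ with i ≟ i′
        ...   | yes ≡.refl = ≐-trans D≐xCi (≐-sym D′≐xCi′)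
        ...   | no i≢i′ = ⊥-elim (x≉y (⁻¹∙≈ε⇒≈ (trivialIntersections i i′ i≢i′ (x ⁻¹ ∙ y)
                                    (proj₁ (D≐xCi y) y∈D) (proj₁ (D′≐xCi′ y) y∈D′))))

        no-4-cycle : ¬ Cycle G π 2
        no-4-cycle cycle = 0≢1 (Ds-distinct zero (suc zero)
            (translates-sharing-two-points-coincide (Ds zero) (Ds (suc zero))
              (adj-here zero) (adj-next zero) (adj-next (suc zero)) (adj-here (suc zero))
              (λ g₀≈g₁ → 0≢1 (gs-distinct zero (suc zero) g₀≈g₁))))
          where
          open Cycle cycle
          0≢1 : ¬ (zero ≡ suc zero)
          0≢1 ()

        cycle-length≥3 : ∀ {m} → Cycle G π m → 3 ≤ m
        cycle-length≥3 {zero}              cycle with () ← Cycle.atLeastTwo cycle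
        cycle-length≥3 {suc zero}          cycle with s≤s () ← Cycle.atLeastTwo cycle
        cycle-length≥3 {suc (suc zero)}    cycle = ⊥-elim (no-4-cycle cycle)
        cycle-length≥3 {suc (suc (suc _))} _     = s≤s (s≤s (s≤s z≤n))

lemma3p4 : ∀ {c ℓ : Level} (G : Group c ℓ) (n k : ℕ) (π : Fin n → Cell G k)
    → CellsDistinct G π
    → CellsOfSizeK G π
    → CellsContainIdentity G π
    → TrivialIntersections G π
    → TAxiom G π
    → ∀ (m : ℕ) → Cycle G π m → 6 ≤ 2 * m
lemma3p4 G n k π _ _ _ trivialIntersections tAxiom m cycle =
  *-monoʳ-≤ 2 (cycle-length≥3 G π tAxiom trivialIntersections cycle)
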